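{- Let $n\ge 2$ be an integer and let $H$ be the $6n\times(4n^2-2n)$ binary matrix defined in the context. Working over $\mathbb{Z}_2$, the rank of $H$ is at most $6n-2$.
   Context: Let $n\ge 2$. For $j\in\{0,1,\dots,2n-1\}$ define $x(j,2)=2j+1$ if $0\le j\le n-1$ and $x(j,2)=2(j-n)$ if $n\le j\le 2n-1$. For each $j\in\{0,\dots,2n-1\}\setminus\{n\}$ and each $a\in\{0,\dots,2n-1\}$ define the block $$B_{ja}=\{\,a,\ ((j+a)\bmod 2n)+2n,\ ((x(j,2)+a)\bmod 2n)+4n\,\}\subseteq\{0,\dots,6n-1\}.$$ Let $H=[h(i,ja)]$ be the $6n\times(4n^2-2n)$ matrix over $\mathbb{Z}_2$ with rows indexed by $i\in\{0,\dots,6n-1\}$, columns indexed by the blocks $B_{ja}$, and $h(i,ja)=1$ iff $i\in B_{ja}$. -}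

module Defs where

open import Data.Bool using (Bool; true; false; _∧_; _∨_; _xor_; if_then_else_)
open import Data.Nat using (ℕ; zero; suc; _+_; _*_; _∸_; _<ᵇ_; _≡ᵇ_)
open import Data.Nat.DivMod using (_%_)
open import Data.Fin using (Fin; toℕ)
import Data.Fin
open import Data.Fin.Subset using (Subset; _⊆_; Nonempty; ∣_∣)
open import Data.Vec using (lookup)
open import Data.Product using (Σ; _×_; proj₁; proj₂)
open import Relation.Binary.PropositionalEquality using (_≡_; _≢_)
open import Relation.Nullary using (¬_)
open import Data.Nat using (_≤_)

-- Generic linear algebra over Z₂ (Bool, with xor as addition, ∧ as
-- multiplication).  A matrix has rows indexed by Fin m and columns
-- indexed by an arbitrary type C.

xorSum : (k : ℕ) → (Fin k → Bool) → Bool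
xorSum zero    f = false
xorSum (suc k) f = f Data.Fin.zero xor xorSum k (λ i → f (Data.Fin.suc i))

rowCombination : {m : ℕ} {C : Set} → (Fin m → C → Bool) → Subset m → C → Bool
rowCombination {m} M T c = xorSum m (λ i → lookup T i ∧ M i c)

RowsLinearlyIndependent : {m : ℕ} {C : Set} → (Fin m → C → Bool) → Subset m → Set
RowsLinearlyIndependent M S =
  ∀ T → T ⊆ S → Nonempty T → ¬ (∀ c → rowCombination M T c ≡ false)

RankAtMost : {m : ℕ} {C : Set} → (Fin m → C → Bool) → ℕ → Set
RankAtMost M r = ∀ S → RowsLinearlyIndependent M S → ∣ S ∣ ≤ r

-- k mod 2n (n = 0 never occurs, since n ≥ 2)
mod2n : ℕ → ℕ → ℕ
mod2n zero    k = k
mod2n (suc m) k = k % (2 * suc m)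

x2 : ℕ → ℕ → ℕ
x2 n j = if j <ᵇ n then 2 * j + 1 else 2 * (j ∸ n)

Col : ℕ → Set
Col n = Σ (Fin (2 * n) × Fin (2 * n)) (λ p → toℕ (proj₁ p) ≢ n)

inBlock : (n i j a : ℕ) → Bool
inBlock n i j a =
  (i ≡ᵇ a) ∨ ((i ≡ᵇ (mod2n n (j + a) + 2 * n)) ∨ (i ≡ᵇ (mod2n n (x2 n j + a) + 4 * n)))

H : (n : ℕ) → Fin (6 * n) → Col n → Bool
H n i c = inBlock n (toℕ i) (toℕ (proj₁ (proj₁ c))) (toℕ (proj₂ (proj₁ c)))

-- Split the 6n rows of H into the three blocks [0,2n), [2n,4n), [4n,6n).
-- Every column of H has exactly one 1 in each block, so for every block
-- the rows outside it sum to zero over Z₂ (each column has two ones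
-- there). An independent set of rows therefore misses a row outside each
-- of the three blocks, and a single row lies outside at most two of them:
-- at least two rows are missed.

module Submission where

open import Defs
open import Algebra.Bundles using (CommutativeRing)
open import Data.Bool using (Bool; true; false; not; _∧_; _∨_; _xor_; if_then_else_)
open import Data.Bool.Properties
  using (xor-∧-commutativeRing; ∧-distribˡ-xor; ∧-identityʳ; ∧-zeroʳ; xor-identityʳ)
open import Data.Empty using (⊥)
open import Data.Fin using (Fin; zero; suc; toℕ; fromℕ<; punchIn)
open import Data.Fin.Patterns using (0F; 1F; 2F)
open import Data.Fin.Properties using (_≟_; toℕ<n; toℕ-fromℕ<; toℕ-injective; ¬∀⟶∃¬; punchInᵢ≢i)
open import Data.Fin.Subset using (Subset; _∈_; _∉_; _⊈_; Nonempty; ∣_∣; _∪_; ⁅_⁆; ∁)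
open import Data.Fin.Subset.Properties
  using (_∈?_; p⊂q⇒∣p∣<∣q∣; p⊆q⇒∣p∣≤∣q∣; p⊆p∪q; x∈p∪q⁻; x∈p∪q⁺; x∈⁅x⁆; x∈⁅y⁆⇒x≡y;
         x∉p⇒x∈∁p; ∣∁p∣≡n∸∣p∣; ∣⁅x⁆∣≡1)
open import Data.Nat using (ℕ; zero; suc; _+_; _*_; _∸_; _≤_; _<_; _≡ᵇ_; z≤n; s≤s)
open import Data.Nat.DivMod using (m%n<n)
open import Data.Nat.Properties
  using (_<?_; ≤-trans; <-≤-trans; <⇒≤pred; pred[m∸n]≡m∸[1+n]; m≤n+m;
         +-monoˡ-<; *-distribʳ-+; ≤⇒≯; *-monoˡ-≤; ≡ᵇ⇒≡)
open import Data.Product using (∃; ∃₂; _×_; _,_; proj₁; proj₂)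
open import Data.Sum using (inj₁; inj₂)
open import Data.Vec using (lookup; tabulate)
open import Data.Vec.Properties using (lookup∘tabulate; []=⇒lookup; lookup⇒[]=)
open import Function using (_∘_)
open import Relation.Binary.Definitions using (DecidableEquality)
open import Relation.Binary.PropositionalEquality
  using (_≡_; _≢_; refl; sym; trans; cong; cong₂; subst; module ≡-Reasoning)
open import Relation.Nullary using (yes; no; does; contradiction)
open import Relation.Nullary.Decidable using (_→-dec_; dec-true; dec-false)

open import Algebra.Properties.CommutativeMonoid.Sum
  (CommutativeRing.+-commutativeMonoid xor-∧-commutativeRing)
  using (sum; sum-cong-≗; sum-replicate-zero; ∑-distrib-+)

xorSum≡sum : ∀ k (f : Fin k → Bool) → xorSum k f ≡ sum f
xorSum≡sum zero    f = refl
xorSum≡sum (suc k) f = cong (f zero xor_) (xorSum≡sum k (f ∘ suc))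

sum-∧-indicator : ∀ {k} (r : Fin k → Bool) (a : Fin k) →
  sum (λ i → r i ∧ (toℕ i ≡ᵇ toℕ a)) ≡ r a
sum-∧-indicator {suc k} r zero = begin
  r zero ∧ true xor sum (λ i → r (suc i) ∧ false)
    ≡⟨ cong₂ _xor_ (∧-identityʳ (r zero)) (sum-cong-≗ {k} (∧-zeroʳ ∘ r ∘ suc)) ⟩
  r zero xor sum {k} (λ _ → false)
    ≡⟨ cong (r zero xor_) (sum-replicate-zero k) ⟩
  r zero xor false
    ≡⟨ xor-identityʳ (r zero) ⟩
  r zero ∎
  where open ≡-Reasoning
sum-∧-indicator r (suc a) =
  trans (cong (_xor sum (λ i → r (suc i) ∧ (toℕ i ≡ᵇ toℕ a))) (∧-zeroʳ (r zero)))
        (sum-∧-indicator (r ∘ suc) a)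

isOneOf : ℕ → ℕ → ℕ → ℕ → Bool
isOneOf a b c i = (i ≡ᵇ a) ∨ ((i ≡ᵇ b) ∨ (i ≡ᵇ c))

≡ᵇ-disjoint : ∀ {a b} i → a ≢ b → (i ≡ᵇ a) ∧ (i ≡ᵇ b) ≡ false
≡ᵇ-disjoint {a} {b} i a≢b with i ≡ᵇ a | ≡ᵇ⇒≡ i a | i ≡ᵇ b | ≡ᵇ⇒≡ i b
... | false | _   | _     | _   = refl
... | true  | _   | false | _   = refl
... | true  | i≡a | true  | i≡b = contradiction (trans (sym (i≡a _)) (i≡b _)) a≢b

∨-disjoint≡xor : ∀ x y z → x ∧ y ≡ false → x ∧ z ≡ false → y ∧ z ≡ false →
  x ∨ (y ∨ z) ≡ x xor (y xor z)
∨-disjoint≡xor false false z     _  _  _  = refl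
∨-disjoint≡xor false true  false _  _  _  = refl
∨-disjoint≡xor false true  true  _  _  ()
∨-disjoint≡xor true  false false _  _  _  = refl
∨-disjoint≡xor true  false true  _  () _
∨-disjoint≡xor true  true  z     () _  _

sum-∧-isOneOf : ∀ {k} (r : Fin k → Bool) (a b c : Fin k) →
  toℕ a ≢ toℕ b → toℕ a ≢ toℕ c → toℕ b ≢ toℕ c →
  sum (λ i → r i ∧ isOneOf (toℕ a) (toℕ b) (toℕ c) (toℕ i)) ≡ r a xor (r b xor r c)
sum-∧-isOneOf {k} r a b c a≢b a≢c b≢c = begin
  sum (λ i → r i ∧ isOneOf (toℕ a) (toℕ b) (toℕ c) (toℕ i))
    ≡⟨ sum-cong-≗ split ⟩
  sum (λ i → δ a i xor (δ b i xor δ c i))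
    ≡⟨ ∑-distrib-+ (δ a) _ ⟩
  sum (δ a) xor sum (λ i → δ b i xor δ c i)
    ≡⟨ cong (sum (δ a) xor_) (∑-distrib-+ (δ b) (δ c)) ⟩
  sum (δ a) xor (sum (δ b) xor sum (δ c))
    ≡⟨ cong₂ _xor_ (sum-∧-indicator r a)
         (cong₂ _xor_ (sum-∧-indicator r b) (sum-∧-indicator r c)) ⟩
  r a xor (r b xor r c) ∎
  where
  open ≡-Reasoning
  δ : Fin k → Fin k → Bool
  δ p i = r i ∧ (toℕ i ≡ᵇ toℕ p)
  split : ∀ i → r i ∧ isOneOf (toℕ a) (toℕ b) (toℕ c) (toℕ i) ≡ δ a i xor (δ b i xor δ c i)
  split i = begin
    r i ∧ isOneOf (toℕ a) (toℕ b) (toℕ c) (toℕ i)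
      ≡⟨ cong (r i ∧_) (∨-disjoint≡xor (toℕ i ≡ᵇ toℕ a) (toℕ i ≡ᵇ toℕ b) (toℕ i ≡ᵇ toℕ c)
           (≡ᵇ-disjoint (toℕ i) a≢b) (≡ᵇ-disjoint (toℕ i) a≢c) (≡ᵇ-disjoint (toℕ i) b≢c)) ⟩
    r i ∧ ((toℕ i ≡ᵇ toℕ a) xor ((toℕ i ≡ᵇ toℕ b) xor (toℕ i ≡ᵇ toℕ c)))
      ≡⟨ ∧-distribˡ-xor (r i) _ _ ⟩
    δ a i xor (r i ∧ ((toℕ i ≡ᵇ toℕ b) xor (toℕ i ≡ᵇ toℕ c)))
      ≡⟨ cong (δ a i xor_) (∧-distribˡ-xor (r i) _ _) ⟩
    δ a i xor (δ b i xor δ c i) ∎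

⊈⇒∃∈∉ : ∀ {n} (T S : Subset n) → T ⊈ S → ∃ λ x → x ∈ T × x ∉ S
⊈⇒∃∈∉ {n} T S T⊈S
  with x , ¬[x∈T⇒x∈S] ← ¬∀⟶∃¬ n (λ x → x ∈ T → x ∈ S) (λ x → (x ∈? T) →-dec (x ∈? S))
                                 (λ f → T⊈S (f _))
  with x ∈? T | x ∈? S
... | yes x∈T | no x∉S = x , x∈T , x∉S
... | _       | yes x∈S = contradiction (λ _ → x∈S) ¬[x∈T⇒x∈S]
... | no x∉T  | _       = contradiction (λ x∈T → contradiction x∈T x∉T) ¬[x∈T⇒x∈S]

independent-misses-dependent : ∀ {m} {C : Set} (M : Fin m → C → Bool) {S T : Subset m} →
  RowsLinearlyIndependent M S → Nonempty T → (∀ c → rowCombination M T c ≡ false) →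
  ∃ λ x → x ∈ T × x ∉ S
independent-misses-dependent M {S} {T} indep T≢∅ T-dependent =
  ⊈⇒∃∈∉ T S (λ T⊆S → indep T T⊆S T≢∅ T-dependent)

∣p∣≤n∸2 : ∀ {n} (p : Subset n) {x y} → x ≢ y → x ∉ p → y ∉ p → ∣ p ∣ ≤ n ∸ 2
∣p∣≤n∸2 {n} p {x} {y} x≢y x∉p y∉p =
  subst (∣ p ∣ ≤_) (pred[m∸n]≡m∸[1+n] n 1) (<⇒≤pred (begin-strict
  ∣ p ∣             <⟨ p⊂q⇒∣p∣<∣q∣ (p⊆p∪q ⁅ x ⁆ , x , x∈p∪q⁺ (inj₂ (x∈⁅x⁆ x)) , x∉p) ⟩
  ∣ p ∪ ⁅ x ⁆ ∣     ≤⟨ p⊆q⇒∣p∣≤∣q∣ (x∉p⇒x∈∁p ∘ ≢y) ⟩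
  ∣ ∁ ⁅ y ⁆ ∣       ≡⟨ ∣∁p∣≡n∸∣p∣ ⁅ y ⁆ ⟩
  n ∸ ∣ ⁅ y ⁆ ∣     ≡⟨ cong (n ∸_) (∣⁅x⁆∣≡1 y) ⟩
  n ∸ 1             ∎))
  where
  open Data.Nat.Properties.≤-Reasoning
  ≢y : ∀ {z} → z ∈ p ∪ ⁅ x ⁆ → z ∉ ⁅ y ⁆
  ≢y z∈p∪x z∈y with refl ← x∈⁅y⁆⇒x≡y y z∈y with x∈p∪q⁻ p ⁅ x ⁆ z∈p∪x
  ... | inj₁ y∈p = y∉p y∈p
  ... | inj₂ y∈x = x≢y (sym (x∈⁅y⁆⇒x≡y x y∈x))

record OneInEachBlock {m} (β : Fin m → Fin 3) (column : Fin m → Bool) : Set where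
  field
    row          : Fin 3 → Fin m
    β-row        : ∀ k → β (row k) ≡ k
    column-ones  : ∀ i → column i ≡ isOneOf (toℕ (row 0F)) (toℕ (row 1F)) (toℕ (row 2F)) (toℕ i)

outside : ∀ {m} → (Fin m → Fin 3) → Fin 3 → Subset m
outside β k = tabulate (λ i → not (does (β i ≟ k)))

∈-outside⁺ : ∀ {m} {β : Fin m → Fin 3} {k x} → β x ≢ k → x ∈ outside β k
∈-outside⁺ {β = β} {k} {x} βx≢k =
  lookup⇒[]= x _ (trans (lookup∘tabulate _ x) (cong not (dec-false (β x ≟ k) βx≢k)))

∈-outside⁻ : ∀ {m} {β : Fin m → Fin 3} {k x} → x ∈ outside β k → β x ≢ k
∈-outside⁻ {β = β} {k} {x} x∈ βx≡k
  with () ← trans (sym ([]=⇒lookup x∈))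
              (trans (lookup∘tabulate _ x) (cong not (dec-true (β x ≟ k) βx≡k)))

outside-parity : (k : Fin 3) →
  not (does (0F ≟ k)) xor (not (does (1F ≟ k)) xor not (does (2F ≟ k))) ≡ false
outside-parity 0F = refl
outside-parity 1F = refl
outside-parity 2F = refl

outside-dependent : ∀ {m} {C : Set} (M : Fin m → C → Bool) (β : Fin m → Fin 3) →
  (∀ c → OneInEachBlock β (λ i → M i c)) → ∀ k c → rowCombination M (outside β k) c ≡ false
outside-dependent {m} M β oneInEach k c = begin
  rowCombination M (outside β k) c
    ≡⟨ xorSum≡sum m _ ⟩
  sum (λ i → lookup (outside β k) i ∧ M i c)
    ≡⟨ sum-cong-≗ (λ i → cong (lookup (outside β k) i ∧_) (column-ones i)) ⟩
  sum (λ i → lookup (outside β k) i ∧ isOneOf (toℕ (row 0F)) (toℕ (row 1F)) (toℕ (row 2F)) (toℕ i))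
    ≡⟨ sum-∧-isOneOf _ (row 0F) (row 1F) (row 2F)
         (distinct 0F 1F λ ()) (distinct 0F 2F λ ()) (distinct 1F 2F λ ()) ⟩
  in-outside 0F xor (in-outside 1F xor in-outside 2F)
    ≡⟨ cong₂ _xor_ (block-of 0F) (cong₂ _xor_ (block-of 1F) (block-of 2F)) ⟩
  not (does (0F ≟ k)) xor (not (does (1F ≟ k)) xor not (does (2F ≟ k)))
    ≡⟨ outside-parity k ⟩
  false ∎
  where
  open ≡-Reasoning
  open OneInEachBlock (oneInEach c)
  in-outside : Fin 3 → Bool
  in-outside l = lookup (outside β k) (row l)
  block-of : ∀ l → in-outside l ≡ not (does (l ≟ k))
  block-of l = trans (lookup∘tabulate _ (row l)) (cong (λ l′ → not (does (l′ ≟ k))) (β-row l))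
  distinct : ∀ l l′ → l ≢ l′ → toℕ (row l) ≢ toℕ (row l′)
  distinct l l′ l≢l′ eq =
    l≢l′ (trans (sym (β-row l)) (trans (cong β (toℕ-injective eq)) (β-row l′)))

fourth-block : (k : Fin 3) → k ≢ 0F → k ≢ 1F → k ≢ 2F → ⊥
fourth-block 0F k≢0 _   _   = k≢0 refl
fourth-block 1F _   k≢1 _   = k≢1 refl
fourth-block 2F _   _   k≢2 = k≢2 refl

outside-all-blocks⇒distinct : ∀ {A : Set} → DecidableEquality A →
  (β : A → Fin 3) (x : Fin 3 → A) → (∀ k → β (x k) ≢ k) → ∃₂ λ k l → x k ≢ x l
outside-all-blocks⇒distinct _≟ᴬ_ β x x∉ with x 0F ≟ᴬ x 1F
... | no x₀≢x₁   = 0F , 1F , x₀≢x₁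
... | yes x₀≡x₁ = 2F , 0F , λ x₂≡x₀ → fourth-block (β (x 0F))
  (x∉ 0F) (λ e → x∉ 1F (trans (cong β (sym x₀≡x₁)) e)) (λ e → x∉ 2F (trans (cong β x₂≡x₀) e))

rank≤m∸2 : ∀ {m} {C : Set} (M : Fin m → C → Bool) (β : Fin m → Fin 3) →
  (∀ k → ∃ λ i → β i ≡ k) → (∀ c → OneInEachBlock β (λ i → M i c)) → RankAtMost M (m ∸ 2)
rank≤m∸2 {m} M β blocks-inhabited oneInEach S indep =
  two-missed (outside-all-blocks⇒distinct _≟_ β (proj₁ ∘ missed)
                (∈-outside⁻ {β = β} ∘ proj₁ ∘ proj₂ ∘ missed))
  where
  outside-nonempty : ∀ k → Nonempty (outside β k)
  outside-nonempty k with i , βi≡ ← blocks-inhabited (punchIn k 0F) =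
    i , ∈-outside⁺ {β = β} (λ βi≡k → punchInᵢ≢i k 0F (trans (sym βi≡) βi≡k))
  missed : ∀ k → ∃ λ x → x ∈ outside β k × x ∉ S
  missed k = independent-misses-dependent M indep (outside-nonempty k)
                                           (outside-dependent M β oneInEach k)
  two-missed : (∃₂ λ k l → proj₁ (missed k) ≢ proj₁ (missed l)) → ∣ S ∣ ≤ m ∸ 2
  two-missed (k , l , x≢y) =
    ∣p∣≤n∸2 S x≢y (proj₂ (proj₂ (missed k))) (proj₂ (proj₂ (missed l)))

blockOf : (p q i : ℕ) → Fin 3
blockOf p q i = if does (i <? p) then 0F else if does (i <? q) then 1F else 2F

blockOf-first : ∀ {p q i} → i < p → blockOf p q i ≡ 0F
blockOf-first {p} {q} {i} i<p rewrite dec-true (i <? p) i<p = refl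

blockOf-second : ∀ {p q i} → p ≤ i → i < q → blockOf p q i ≡ 1F
blockOf-second {p} {q} {i} p≤i i<q
  rewrite dec-false (i <? p) (≤⇒≯ p≤i) | dec-true (i <? q) i<q = refl

blockOf-third : ∀ {p q i} → p ≤ q → q ≤ i → blockOf p q i ≡ 2F
blockOf-third {p} {q} {i} p≤q q≤i
  rewrite dec-false (i <? p) (≤⇒≯ (≤-trans p≤q q≤i)) | dec-false (i <? q) (≤⇒≯ q≤i) = refl

module BlocksOfH (n : ℕ) where

  N : ℕ
  N = suc n

  blockH : Fin (6 * N) → Fin 3
  blockH i = blockOf (2 * N) (4 * N) (toℕ i)

  2N≤4N : 2 * N ≤ 4 * N
  2N≤4N = *-monoˡ-≤ N {2} {4} (s≤s (s≤s z≤n))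

  4N≤6N : 4 * N ≤ 6 * N
  4N≤6N = *-monoˡ-≤ N {4} {6} (s≤s (s≤s (s≤s (s≤s z≤n))))

  +2N<4N : ∀ {t} → t < 2 * N → t + 2 * N < 4 * N
  +2N<4N {t} t<2N = subst (t + 2 * N <_) (sym (*-distribʳ-+ N 2 2)) (+-monoˡ-< (2 * N) t<2N)

  +4N<6N : ∀ {t} → t < 2 * N → t + 4 * N < 6 * N
  +4N<6N {t} t<2N = subst (t + 4 * N <_) (sym (*-distribʳ-+ N 2 4)) (+-monoˡ-< (4 * N) t<2N)

  H-oneInEachBlock : ∀ c → OneInEachBlock blockH (λ i → H N i c)
  H-oneInEachBlock col@((j , a) , _) =
    record { row = row ; β-row = β-row ; column-ones = column-ones }
    where
    b c : ℕ
    b = mod2n N (toℕ j + toℕ a)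
    c = mod2n N (x2 N (toℕ j) + toℕ a)
    b<2N : b < 2 * N
    b<2N = m%n<n (toℕ j + toℕ a) (2 * N)
    c<2N : c < 2 * N
    c<2N = m%n<n (x2 N (toℕ j) + toℕ a) (2 * N)
    value : Fin 3 → ℕ
    value 0F = toℕ a
    value 1F = b + 2 * N
    value 2F = c + 4 * N
    value<6N : ∀ k → value k < 6 * N
    value<6N 0F = <-≤-trans (toℕ<n a) (≤-trans 2N≤4N 4N≤6N)
    value<6N 1F = <-≤-trans (+2N<4N b<2N) 4N≤6N
    value<6N 2F = +4N<6N c<2N
    blockOf-value : ∀ k → blockOf (2 * N) (4 * N) (value k) ≡ k
    blockOf-value 0F = blockOf-first {q = 4 * N} (toℕ<n a)
    blockOf-value 1F = blockOf-second (m≤n+m (2 * N) b) (+2N<4N b<2N)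
    blockOf-value 2F = blockOf-third 2N≤4N (m≤n+m (4 * N) c)
    row : Fin 3 → Fin (6 * N)
    row k = fromℕ< (value<6N k)
    β-row : ∀ k → blockH (row k) ≡ k
    β-row k = trans (cong (blockOf (2 * N) (4 * N)) (toℕ-fromℕ< (value<6N k))) (blockOf-value k)
    column-ones : ∀ i → H N i col ≡ isOneOf (toℕ (row 0F)) (toℕ (row 1F)) (toℕ (row 2F)) (toℕ i)
    column-ones i
      rewrite toℕ-fromℕ< (value<6N 0F) | toℕ-fromℕ< (value<6N 1F) | toℕ-fromℕ< (value<6N 2F) = refl

lemma4p2 : (n : ℕ) → 2 ≤ n → RankAtMost (H n) (6 * n ∸ 2)
lemma4p2 zero    ()
-- The argument works for every n ≥ 1; the hypothesis only rules out n = 0.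
lemma4p2 (suc n) _  = rank≤m∸2 (H (suc n)) blockH blocks-inhabited H-oneInEachBlock
  where
  open BlocksOfH n
  blocks-inhabited : ∀ k → ∃ λ i → blockH i ≡ k
  blocks-inhabited k = row k , β-row k
    where open OneInEachBlock (H-oneInEachBlock ((0F , 0F) , λ ()))
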